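{- Let $k\ge2$ and let $L=c_1H_1+\dots+c_mH_m\in\Gamma_k$ be a linear combination of $k$-vertex-labelled graphs with $L\in\operatorname{Ker}(X_k)$, and let $\pi=\pi_{\Gamma_2}\circ\dots\circ\pi_{\Gamma_k}:\Gamma_k\to\Gamma_1$. Then $\pi(L)\in\operatorname{Ker}(X_1)$, i.e. the corresponding linear combination of (unlabelled-by-part) graphs has zero chromatic symmetric function.
   Context: For $k\ge1$: for $i\ge1$, $1\le j\le k$ let $(x_i)_j$ be commuting indeterminates, $x_i^\alpha=\prod_j((x_i)_j)^{\alpha_j}$ for $\alpha\in\mathbb{Z}_{\ge0}^k$; $\Lambda_k$ is the $\mathbb{C}$-vector space of bounded-degree formal power series in the $(x_i)_j$ invariant under $(x_i)_j\mapsto(x_{\sigma(i)})_j$ (all $j$ simultaneously) for each permutation $\sigma$ of the positive integers ($\Lambda_1$ is the usual ring of symmetric functions). $\epsilon_i$ is the $i$-th unit vector of $\mathbb{Z}_{\ge0}^k$. A $k$-vertex-labelled graph is a finite graph (multiple edges allowed) with vertex set $\{(i,j):1\le i\le k,1\le j\le\alpha_i\}$ for some $\alpha\in\mathbb{Z}_{\ge0}^k$, vertex $(i,j)$ having weight $\epsilon_i$. $\Gamma_k$ is the $\mathbb{C}$-vector space of formal linear combinations of $k$-vertex-labelled graphs, and $X_k:\Gamma_k\to\Lambda_k$ is the linear map sending $G$ to $\sum_\kappa\prod_v x_{\kappa(v)}^{w(v)}$ over proper colorings $\kappa:V(G)\to\mathbb{Z}_{>0}$; $X_1$ is Stanley's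 chromatic symmetric function. $\pi_{\Gamma_k}:\Gamma_k\to\Gamma_{k-1}$ is the linear map relabelling each vertex $(k,j)$ as $(k-1,\alpha_{k-1}+j)$, leaving adjacencies unchanged. -}

module Defs where

open import Level using (Level)
open import Data.Nat using (ℕ; zero; suc; _+_)
open import Data.Nat.Properties using (+-assoc)
open import Data.Fin using (Fin; zero; suc; splitAt; cast; _≟_)
open import Data.Fin.Properties using () renaming (all? to allFin?)
open import Data.Sum using ([_,_]′)
open import Data.Product using (_×_; _,_; proj₁; proj₂)
open import Data.List using (List; []; _∷_; map; concatMap; filter; length; allFin)
open import Data.List.Relation.Unary.All using (All; all?)
open import Data.Vec using (Vec; []; _∷_; sum; tabulate)
import Data.Vec.Properties as VecP
import Data.Nat as ℕ
open import Relation.Nullary using (Dec; ¬_; _×-dec_)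
open import Relation.Nullary.Decidable using (¬?)
open import Relation.Binary.PropositionalEquality using (_≡_; _≢_; refl; cong; trans; sym)
open import Algebra.Bundles using (CommutativeRing)
import Algebra.Definitions.RawMonoid as RM

-- A k-vertex-labelled graph with part sizes α = (α₁,…,α_k) has vertex
-- set {(i,j) : 1 ≤ i ≤ k, 1 ≤ j ≤ α_i}.  We encode the vertex (i,j) by
-- its position α₁+…+α_{i-1}+(j-1) in the lexicographic order, i.e. the
-- vertex set is Fin (sum α), listed block by block.  Edges form a list
-- (so multiple edges are allowed) of unordered pairs, each given by
-- its two endpoints.

record Graph (k : ℕ) : Set where
  constructor graph
  field
    α     : Vec ℕ k
    edges : List (Fin (sum α) × Fin (sum α))
open Graph public

Loopless : ∀ {k} → Graph k → Set
Loopless G = All (λ e → proj₁ e ≢ proj₂ e) (edges G)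

-- the first index i of the vertex (i,j); its weight is ε_i
block : ∀ {k} (α : Vec ℕ k) → Fin (sum α) → Fin k
block (a ∷ α) v = [ (λ _ → zero) , (λ w → suc (block α w)) ]′ (splitAt a v)

-- Vertex (k,j) becomes (k-1, α_{k-1}+j); in the
-- lexicographic encoding this merges the last two blocks and leaves the
-- position of every vertex unchanged.

merge : ∀ {k} → Vec ℕ (suc (suc k)) → Vec ℕ (suc k)
merge {zero}  (a ∷ b ∷ []) = (a + b) ∷ []
merge {suc k} (a ∷ α)      = a ∷ merge α

sum-merge : ∀ {k} (α : Vec ℕ (suc (suc k))) → sum (merge α) ≡ sum α
sum-merge {zero}  (a ∷ b ∷ []) = +-assoc a b 0
sum-merge {suc k} (a ∷ α)      = cong (a +_) (sum-merge α)

πΓ : ∀ {k} → Graph (suc (suc k)) → Graph (suc k)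
πΓ (graph α es) =
  graph (merge α) (map (λ e → cast (sym (sum-merge α)) (proj₁ e) ,
                              cast (sym (sum-merge α)) (proj₂ e)) es)

πAll : ∀ {k} → Graph (suc k) → Graph 1
πAll {zero}  G = G
πAll {suc k} G = πAll (πΓ G)

-- A monomial in the variables (x_c)_j is given by some N and exponent
-- vectors e : Fin N → ℕ^k (e c = exponent vector of x_{c+1}; variables
-- x_c with c > N have exponent 0).  Its coefficient in X_k(G) is the
-- number of proper colourings κ with ∏_v x_{κ(v)}^{w(v)} equal to it;
-- such κ only use colours 1..N, so we count κ : V(G) → Fin N.

allFuns : (n N : ℕ) → List (Fin n → Fin N)
allFuns zero    N = (λ ()) ∷ []
allFuns (suc n) N =
  concatMap (λ f → map (λ c → λ { zero → c ; (suc i) → f i }) (allFin N))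
            (allFuns n N)

countFin : ∀ {n} {P : Fin n → Set} → (∀ v → Dec (P v)) → ℕ
countFin {n} P? = length (filter P? (allFin n))

colourWeight : ∀ {k} (α : Vec ℕ k) {N : ℕ} → (Fin (sum α) → Fin N) → Fin N → Vec ℕ k
colourWeight α κ c = tabulate (λ i → countFin (λ v → (κ v ≟ c) ×-dec (block α v ≟ i)))

Proper : ∀ {k} (G : Graph k) {N : ℕ} → (Fin (sum (α G)) → Fin N) → Set
Proper G κ = All (λ e → κ (proj₁ e) ≢ κ (proj₂ e)) (edges G)

proper? : ∀ {k} (G : Graph k) {N : ℕ} (κ : Fin (sum (α G)) → Fin N) → Dec (Proper G κ)
proper? G κ = all? (λ e → ¬? (κ (proj₁ e) ≟ κ (proj₂ e))) (edges G)

coeffX : ∀ {k} (G : Graph k) (N : ℕ) (e : Fin N → Vec ℕ k) → ℕ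
coeffX {k} G N e =
  length (filter (λ κ → proper? G κ ×-dec
                        allFin? (λ c → VecP.≡-dec ℕ._≟_ (colourWeight (α G) κ c) (e c)))
                 (allFuns (sum (α G)) N))

module _ {c ℓ : Level} (R : CommutativeRing c ℓ) where
  open CommutativeRing R
  open RM +-rawMonoid using () renaming (_×_ to _·ℕ_; sum to Σᴿ)

  record LinComb (k : ℕ) : Set c where
    constructor lincomb
    field
      m    : ℕ
      coef : Fin m → Carrier
      term : Fin m → Graph k
  open LinComb public

  InKerX : ∀ {k} → LinComb k → Set ℓ
  InKerX {k} L = ∀ (N : ℕ) (e : Fin N → Vec ℕ k) →
    Σᴿ (λ i → coef L i * (coeffX (term L i) N e ·ℕ 1#)) ≈ 0#

  πL : ∀ {k} → LinComb (suc k) → LinComb 1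
  πL (lincomb m c H) = lincomb m c (λ i → πAll (H i))

-- Relabelling the last part as the part before it (π_{Γ_k}) changes neither the
-- vertices nor the edges, so it preserves proper colourings; it only adds together
-- the exponents of (x_c)_{k-1} and (x_c)_k in each colouring's monomial. Hence the
-- coefficient of a monomial e in X_{k-1}(π_{Γ_k} G) is the sum of the coefficients
-- of X_k(G) at the finitely many monomials e′ that merge to e, i.e. X_{k-1} ∘ π_{Γ_k}
-- is X_k followed by the linear specialisation (x_c)_k ↦ (x_c)_{k-1}. Linearity
-- then carries Ker X_k into Ker X_{k-1}, and we iterate down to k = 1.

module Submission where

open import Defs
open import Level using (Level)
open import Data.Bool using (Bool; true; false; _∧_)
open import Data.Nat using (ℕ; zero; suc; _+_; _*_; _∸_; _<_; s≤s)
import Data.Nat.Properties as ℕ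
open import Data.Fin using (Fin; zero; suc; cast; _≟_; splitAt)
open import Data.Fin.Properties using (cast-is-id; cast-involutive; ∀-cons-⇔) renaming (all? to allFin?)
open import Data.Sum using (_⊎_; inj₁; inj₂)
import Data.Sum as Sum
open import Data.Product using (_×_; _,_; proj₁; proj₂; assocˡ′; assocʳ′)
open import Data.Product.Function.NonDependent.Propositional using (_×-⇔_)
open import Data.Empty using (⊥-elim)
open import Data.List using (List; []; _∷_; map; concatMap; filter; length; allFin; _++_; downFrom)
import Data.List.Relation.Unary.All as All
import Data.List.Relation.Unary.All.Properties as All
open import Data.Vec using (Vec; []; _∷_; tabulate; sum)
import Data.Vec.Functional as Vector
open import Relation.Binary.Definitions using (DecidableEquality)
import Data.Vec.Properties as Vec
open import Function using (_∘_; _⇔_; mk⇔; Equivalence)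
import Function.Properties.Equivalence as ⇔
open import Relation.Nullary using (Dec; yes; no; ¬_; _×-dec_; does; ¬?)
open import Relation.Nullary.Decidable using (does-⇔; dec-true; dec-false)
open import Relation.Binary.PropositionalEquality
  using (_≡_; _≢_; refl; sym; trans; cong; cong₂; subst; subst₂; module ≡-Reasoning)
open import Algebra.Bundles using (CommutativeRing)
import Algebra.Definitions.RawMonoid as RawMonoid
open import Algebra.Properties.CommutativeSemigroup ℕ.+-commutativeSemigroup using (interchange)

open Equivalence using (to; from)

transˡ-⇔ : ∀ {a} {A : Set a} {x y z : A} → x ≡ y → (x ≡ z) ⇔ (y ≡ z)
transˡ-⇔ x≡y = mk⇔ (trans (sym x≡y)) (trans x≡y)

∀-transˡ-⇔ : ∀ {a} {I : Set} {A : Set a} {x y z : I → A} →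
  (∀ c → x c ≡ y c) → (∀ c → x c ≡ z c) ⇔ (∀ c → y c ≡ z c)
∀-transˡ-⇔ x≗y = mk⇔ (λ x≗z c → trans (sym (x≗y c)) (x≗z c)) (λ y≗z c → trans (x≗y c) (y≗z c))

bit : Bool → ℕ
bit true  = 1
bit false = 0

bit-∧ : ∀ a b → bit (a ∧ b) ≡ bit a * bit b
bit-∧ true  b = sym (ℕ.+-identityʳ (bit b))
bit-∧ false b = refl

𝟙 : ∀ {p} {P : Set p} → Dec P → ℕ
𝟙 P? = bit (does P?)

module _ {p q} {P : Set p} {Q : Set q} where

  𝟙-cong : P ⇔ Q → (P? : Dec P) (Q? : Dec Q) → 𝟙 P? ≡ 𝟙 Q?
  𝟙-cong P⇔Q P? Q? = cong bit (does-⇔ P⇔Q P? Q?)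

  𝟙-× : (P? : Dec P) (Q? : Dec Q) → 𝟙 (P? ×-dec Q?) ≡ 𝟙 P? * 𝟙 Q?
  𝟙-× P? Q? = bit-∧ (does P?) (does Q?)

𝟙-yes : ∀ {p} {P : Set p} (P? : Dec P) → P → 𝟙 P? ≡ 1
𝟙-yes P? x = cong bit (dec-true P? x)

𝟙-no : ∀ {p} {P : Set p} (P? : Dec P) → ¬ P → 𝟙 P? ≡ 0
𝟙-no P? ¬x = cong bit (dec-false P? ¬x)

𝟙-allFin-cons : ∀ {N} {P : Fin (suc N) → Set} (P? : ∀ c → Dec (P c)) →
  𝟙 (allFin? P?) ≡ 𝟙 (P? zero) * 𝟙 (allFin? (P? ∘ suc))
𝟙-allFin-cons P? =
  trans (𝟙-cong (⇔.sym ∀-cons-⇔) (allFin? P?) (P? zero ×-dec allFin? (P? ∘ suc)))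
        (𝟙-× (P? zero) (allFin? (P? ∘ suc)))

_≟ᵛ_ : ∀ {n} → DecidableEquality (Vec ℕ n)
_≟ᵛ_ = Vec.≡-dec ℕ._≟_

𝟙-∷ : ∀ {n} (x y : ℕ) (xs ys : Vec ℕ n) → 𝟙 ((x ∷ xs) ≟ᵛ (y ∷ ys)) ≡ 𝟙 (x ℕ.≟ y) * 𝟙 (xs ≟ᵛ ys)
𝟙-∷ x y xs ys = bit-∧ (does (x ℕ.≟ y)) (does (xs ≟ᵛ ys))

𝟙-∷[] : ∀ (x y : ℕ) → 𝟙 ((x ∷ []) ≟ᵛ (y ∷ [])) ≡ 𝟙 (x ℕ.≟ y)
𝟙-∷[] x y = trans (𝟙-∷ x y [] []) (ℕ.*-identityʳ _)

module _ {a} {A : Set a} where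

  ∑ : List A → (A → ℕ) → ℕ
  ∑ []       f = 0
  ∑ (x ∷ xs) f = f x + ∑ xs f

  ∑-cong : ∀ xs {f g : A → ℕ} → (∀ x → f x ≡ g x) → ∑ xs f ≡ ∑ xs g
  ∑-cong []       f≗g = refl
  ∑-cong (x ∷ xs) f≗g = cong₂ _+_ (f≗g x) (∑-cong xs f≗g)

  ∑-++ : ∀ xs ys (f : A → ℕ) → ∑ (xs ++ ys) f ≡ ∑ xs f + ∑ ys f
  ∑-++ []       ys f = refl
  ∑-++ (x ∷ xs) ys f = trans (cong (f x +_) (∑-++ xs ys f)) (sym (ℕ.+-assoc (f x) _ _))

  ∑-zero : ∀ xs → ∑ xs (λ _ → 0) ≡ 0
  ∑-zero []       = refl
  ∑-zero (_ ∷ xs) = ∑-zero xs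

  ∑-+ : ∀ xs (f g : A → ℕ) → ∑ xs (λ x → f x + g x) ≡ ∑ xs f + ∑ xs g
  ∑-+ []       f g = refl
  ∑-+ (x ∷ xs) f g =
    trans (cong (f x + g x +_) (∑-+ xs f g)) (interchange (f x) (g x) (∑ xs f) (∑ xs g))

  ∑-*ˡ : ∀ c xs (f : A → ℕ) → ∑ xs (λ x → c * f x) ≡ c * ∑ xs f
  ∑-*ˡ c []       f = sym (ℕ.*-zeroʳ c)
  ∑-*ˡ c (x ∷ xs) f =
    trans (cong (c * f x +_) (∑-*ˡ c xs f)) (sym (ℕ.*-distribˡ-+ c (f x) _))

  ∑-*ʳ : ∀ c xs (f : A → ℕ) → ∑ xs (λ x → f x * c) ≡ ∑ xs f * c
  ∑-*ʳ c []       f = refl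
  ∑-*ʳ c (x ∷ xs) f =
    trans (cong (f x * c +_) (∑-*ʳ c xs f)) (sym (ℕ.*-distribʳ-+ c (f x) _))

  length-filter≡∑𝟙 : ∀ {p} {P : A → Set p} (P? : ∀ x → Dec (P x)) xs →
    length (filter P? xs) ≡ ∑ xs (𝟙 ∘ P?)
  length-filter≡∑𝟙 P? []       = refl
  length-filter≡∑𝟙 P? (x ∷ xs) with P? x
  ... | yes _ = cong suc (length-filter≡∑𝟙 P? xs)
  ... | no  _ = length-filter≡∑𝟙 P? xs

module _ {a b} {A : Set a} {B : Set b} where

  ∑-map : ∀ (g : A → B) xs (f : B → ℕ) → ∑ (map g xs) f ≡ ∑ xs (f ∘ g)
  ∑-map g []       f = refl
  ∑-map g (x ∷ xs) f = cong (f (g x) +_) (∑-map g xs f)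

  ∑-concatMap : ∀ (g : A → List B) xs (f : B → ℕ) →
    ∑ (concatMap g xs) f ≡ ∑ xs (λ x → ∑ (g x) f)
  ∑-concatMap g []       f = refl
  ∑-concatMap g (x ∷ xs) f =
    trans (∑-++ (g x) (concatMap g xs) f) (cong (∑ (g x) f +_) (∑-concatMap g xs f))

  ∑-swap : ∀ xs ys (f : A → B → ℕ) → ∑ xs (λ x → ∑ ys (f x)) ≡ ∑ ys (λ y → ∑ xs (λ x → f x y))
  ∑-swap []       ys f = sym (∑-zero ys)
  ∑-swap (x ∷ xs) ys f =
    trans (cong (∑ ys (f x) +_) (∑-swap xs ys f)) (sym (∑-+ ys (f x) (λ y → ∑ xs (λ x → f x y))))

∑-downFrom-sift : ∀ a n (g : ℕ → ℕ) → ∑ (downFrom n) (λ x → 𝟙 (a ℕ.≟ x) * g x) ≡ 𝟙 (a ℕ.<? n) * g a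
∑-downFrom-sift a zero    g = cong (_* g a) (sym (𝟙-no (a ℕ.<? 0) λ ()))
∑-downFrom-sift a (suc n) g with a ℕ.≟ n
... | yes refl = begin
  𝟙 (a ℕ.≟ a) * g a + ∑ (downFrom a) (λ x → 𝟙 (a ℕ.≟ x) * g x)
    ≡⟨ cong₂ (λ b s → b * g a + s) (𝟙-yes (a ℕ.≟ a) refl) (∑-downFrom-sift a a g) ⟩
  1 * g a + 𝟙 (a ℕ.<? a) * g a
    ≡⟨ cong (λ b → 1 * g a + b * g a) (𝟙-no (a ℕ.<? a) (ℕ.n≮n a)) ⟩
  1 * g a + 0
    ≡⟨ ℕ.+-identityʳ _ ⟩
  1 * g a
    ≡⟨ cong (_* g a) (𝟙-yes (a ℕ.<? suc a) ℕ.≤-refl) ⟨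
  𝟙 (a ℕ.<? suc a) * g a
    ∎
  where open ≡-Reasoning
... | no a≢n = begin
  𝟙 (a ℕ.≟ n) * g n + ∑ (downFrom n) (λ x → 𝟙 (a ℕ.≟ x) * g x)
    ≡⟨ cong₂ (λ b s → b * g n + s) (𝟙-no (a ℕ.≟ n) a≢n) (∑-downFrom-sift a n g) ⟩
  𝟙 (a ℕ.<? n) * g a
    ≡⟨ cong (_* g a) (𝟙-cong a<n⇔a<1+n (a ℕ.<? n) (a ℕ.<? suc n)) ⟩
  𝟙 (a ℕ.<? suc n) * g a
    ∎
  where
  open ≡-Reasoning
  a<n⇔a<1+n : a < n ⇔ a < suc n
  a<n⇔a<1+n = mk⇔ ℕ.m≤n⇒m≤1+n (λ a<1+n → ℕ.≤∧≢⇒< (ℕ.≤-pred a<1+n) a≢n)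

module _ {n} {P Q : Fin n → Set} where

  countFin-cong : (∀ v → P v ⇔ Q v) → (P? : ∀ v → Dec (P v)) (Q? : ∀ v → Dec (Q v)) →
    countFin P? ≡ countFin Q?
  countFin-cong P⇔Q P? Q? = begin
    countFin P?               ≡⟨ length-filter≡∑𝟙 P? (allFin n) ⟩
    ∑ (allFin n) (𝟙 ∘ P?)     ≡⟨ ∑-cong (allFin n) (λ v → 𝟙-cong (P⇔Q v) (P? v) (Q? v)) ⟩
    ∑ (allFin n) (𝟙 ∘ Q?)     ≡⟨ length-filter≡∑𝟙 Q? (allFin n) ⟨
    countFin Q?               ∎
    where open ≡-Reasoning

countFin-cast : ∀ {m n} (m≡n : m ≡ n) {P : Fin m → Set} (P? : ∀ v → Dec (P v)) →
  countFin P? ≡ countFin (P? ∘ cast (sym m≡n))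
countFin-cast refl {P} P? =
  countFin-cong (λ v → mk⇔ (subst P (sym (cast-is-id refl v))) (subst P (cast-is-id refl v)))
                P? (P? ∘ cast refl)

countFin-⊎ : ∀ {n} {P Q S : Fin n → Set} →
  (∀ v → S v ⇔ (P v ⊎ Q v)) → (∀ v → P v → ¬ Q v) →
  (P? : ∀ v → Dec (P v)) (Q? : ∀ v → Dec (Q v)) (S? : ∀ v → Dec (S v)) →
  countFin S? ≡ countFin P? + countFin Q?
countFin-⊎ {n} S⇔P⊎Q disjoint P? Q? S? = begin
  countFin S?                                       ≡⟨ length-filter≡∑𝟙 S? (allFin n) ⟩
  ∑ (allFin n) (𝟙 ∘ S?)                             ≡⟨ ∑-cong (allFin n) pointwise ⟩
  ∑ (allFin n) (λ v → 𝟙 (P? v) + 𝟙 (Q? v))          ≡⟨ ∑-+ (allFin n) (𝟙 ∘ P?) (𝟙 ∘ Q?) ⟩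
  ∑ (allFin n) (𝟙 ∘ P?) + ∑ (allFin n) (𝟙 ∘ Q?)     ≡⟨ cong₂ _+_ (length-filter≡∑𝟙 P? (allFin n))
                                                                 (length-filter≡∑𝟙 Q? (allFin n)) ⟨
  countFin P? + countFin Q?                         ∎
  where
  open ≡-Reasoning
  pointwise : ∀ v → 𝟙 (S? v) ≡ 𝟙 (P? v) + 𝟙 (Q? v)
  pointwise v with P? v | Q? v
  ... | yes p | yes q = ⊥-elim (disjoint v p q)
  ... | yes p | no  _ = 𝟙-yes (S? v) (from (S⇔P⊎Q v) (inj₁ p))
  ... | no  _ | yes q = 𝟙-yes (S? v) (from (S⇔P⊎Q v) (inj₂ q))
  ... | no ¬p | no ¬q = 𝟙-no (S? v) (Sum.[ ¬p , ¬q ] ∘ to (S⇔P⊎Q v))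

mergeIndex : ∀ {k} → Fin (suc (suc k)) → Fin (suc k)
mergeIndex {zero}  _       = zero
mergeIndex {suc k} zero    = zero
mergeIndex {suc k} (suc i) = suc (mergeIndex i)

-- The value at zero is junk: unsuc is only used on indices known to be nonzero.
unsuc : ∀ {k} → Fin (suc (suc k)) → Fin (suc k)
unsuc zero    = zero
unsuc (suc j) = j

mergeIndex≡zero⇔ : ∀ {k} (x : Fin (3 + k)) → (mergeIndex x ≡ zero) ⇔ (x ≡ zero)
mergeIndex≡zero⇔ zero    = mk⇔ (λ _ → refl) (λ _ → refl)
mergeIndex≡zero⇔ (suc x) = mk⇔ (λ ()) (λ ())

mergeIndex≡suc⇔ : ∀ {k} (x : Fin (3 + k)) (i : Fin (suc k)) →
  (mergeIndex x ≡ suc i) ⇔ (x ≢ zero × mergeIndex (unsuc x) ≡ i)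
mergeIndex≡suc⇔ zero    i = mk⇔ (λ ()) (λ (x≢0 , _) → ⊥-elim (x≢0 refl))
mergeIndex≡suc⇔ (suc x) i = mk⇔ (λ { refl → (λ ()) , refl }) (λ { (_ , refl) → refl })

≡suc⇔ : ∀ {k} (x : Fin (3 + k)) (j : Fin (2 + k)) → (x ≡ suc j) ⇔ (x ≢ zero × unsuc x ≡ j)
≡suc⇔ zero    j = mk⇔ (λ ()) (λ (x≢0 , _) → ⊥-elim (x≢0 refl))
≡suc⇔ (suc x) j = mk⇔ (λ { refl → (λ ()) , refl }) (λ { (_ , refl) → refl })

-- colourWeight α κ c is, by definition, histogram (λ v → κ v ≟ c) (block α).
histogram : ∀ {n K} {Q : Fin n → Set} → (∀ v → Dec (Q v)) → (Fin n → Fin K) → Vec ℕ K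
histogram Q? g = tabulate (λ i → countFin (λ v → Q? v ×-dec (g v ≟ i)))

histogram-cong : ∀ {n K} {Q Q′ : Fin n → Set} {g g′ : Fin n → Fin K} →
  (∀ v → Q v ⇔ Q′ v) → (∀ v → g v ≡ g′ v) →
  (Q? : ∀ v → Dec (Q v)) (Q′? : ∀ v → Dec (Q′ v)) → histogram Q? g ≡ histogram Q′? g′
histogram-cong Q⇔Q′ g≗g′ Q? Q′? = Vec.tabulate-cong λ i →
  countFin-cong (λ v → Q⇔Q′ v ×-⇔ transˡ-⇔ (g≗g′ v))
                (λ v → Q? v ×-dec (_ ≟ i)) (λ v → Q′? v ×-dec (_ ≟ i))

histogram-merge : ∀ {k n} {Q : Fin n → Set} (Q? : ∀ v → Dec (Q v)) (g : Fin n → Fin (2 + k)) →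
  histogram Q? (mergeIndex ∘ g) ≡ merge (histogram Q? g)
histogram-merge {zero} {Q = Q} Q? g = cong (_∷ []) (countFin-⊎ split disjoint
  (λ v → Q? v ×-dec (g v ≟ zero)) (λ v → Q? v ×-dec (g v ≟ suc zero))
  (λ v → Q? v ×-dec (zero ≟ zero)))
  where
  split : ∀ v → (Q v × zero ≡ zero) ⇔ ((Q v × g v ≡ zero) ⊎ (Q v × g v ≡ suc zero))
  split v = mk⇔ (λ (q , _) → byValue q (g v)) Sum.[ (λ (q , _) → q , refl) , (λ (q , _) → q , refl) ]
    where
    byValue : ∀ {A : Set} → A → (x : Fin 2) → (A × x ≡ zero) ⊎ (A × x ≡ suc zero)
    byValue q zero       = inj₁ (q , refl)
    byValue q (suc zero) = inj₂ (q , refl)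
  disjoint : ∀ v → Q v × g v ≡ zero → ¬ (Q v × g v ≡ suc zero)
  disjoint v (_ , g≡0) (_ , g≡1) with trans (sym g≡0) g≡1
  ... | ()
histogram-merge {suc k} {Q = Q} Q? g = cong₂ _∷_
  (countFin-cong (λ v → ⇔.refl ×-⇔ mergeIndex≡zero⇔ (g v))
                 (λ v → Q? v ×-dec (mergeIndex (g v) ≟ zero)) (λ v → Q? v ×-dec (g v ≟ zero)))
  (begin
    tabulate (λ i → countFin (λ v → Q? v ×-dec (mergeIndex (g v) ≟ suc i)))
      ≡⟨ Vec.tabulate-cong (λ i → countFin-cong (λ v → reassoc (mergeIndex≡suc⇔ (g v) i))
           (λ v → Q? v ×-dec (mergeIndex (g v) ≟ suc i))
           (λ v → Q′? v ×-dec (mergeIndex (unsuc (g v)) ≟ i))) ⟩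
    histogram Q′? (mergeIndex ∘ unsuc ∘ g)
      ≡⟨ histogram-merge Q′? (unsuc ∘ g) ⟩
    merge (histogram Q′? (unsuc ∘ g))
      ≡⟨ cong merge (Vec.tabulate-cong λ j → countFin-cong (λ v → ⇔.sym (reassoc (≡suc⇔ (g v) j)))
           (λ v → Q′? v ×-dec (unsuc (g v) ≟ j)) (λ v → Q? v ×-dec (g v ≟ suc j))) ⟩
    merge (tabulate (λ j → countFin (λ v → Q? v ×-dec (g v ≟ suc j))))
      ∎)
  where
  open ≡-Reasoning
  Q′? : ∀ v → Dec (Q v × g v ≢ zero)
  Q′? v = Q? v ×-dec ¬? (g v ≟ zero)
  reassoc : ∀ {A B C D : Set} → B ⇔ (C × D) → (A × B) ⇔ ((A × C) × D)
  reassoc B⇔C×D = ⇔.trans (⇔.refl ×-⇔ B⇔C×D) (mk⇔ assocˡ′ assocʳ′)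

histogram-cast : ∀ {m n K} (m≡n : m ≡ n) {Q : Fin m → Set} (Q? : ∀ v → Dec (Q v)) (g : Fin m → Fin K) →
  histogram Q? g ≡ histogram (Q? ∘ cast (sym m≡n)) (g ∘ cast (sym m≡n))
histogram-cast m≡n Q? g = Vec.tabulate-cong λ i → countFin-cast m≡n (λ v → Q? v ×-dec (g v ≟ i))

splitAt-cast : ∀ a {m m′} (m≡m′ : m ≡ m′) (v : Fin (a + m)) →
  splitAt a (cast (cong (a +_) m≡m′) v) ≡ Sum.map₂ (cast m≡m′) (splitAt a v)
splitAt-cast zero    m≡m′ v       = refl
splitAt-cast (suc a) m≡m′ zero    = refl
splitAt-cast (suc a) m≡m′ (suc v) rewrite splitAt-cast a m≡m′ v with splitAt a v
... | inj₁ _ = refl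
... | inj₂ _ = refl

block-merge : ∀ {k} (α : Vec ℕ (2 + k)) (v : Fin (sum α)) →
  block (merge α) (cast (sym (sum-merge α)) v) ≡ mergeIndex (block α v)
block-merge {zero} α v with block (merge α) (cast (sym (sum-merge α)) v)
... | zero = refl
block-merge {suc k} (a ∷ α) v rewrite splitAt-cast a (sym (sum-merge α)) v with splitAt a v
... | inj₁ _ = refl
... | inj₂ w = cong suc (block-merge α w)

colourWeight-merge : ∀ {k} (α : Vec ℕ (2 + k)) {N} (κ : Fin (sum α) → Fin N) (c : Fin N) →
  colourWeight (merge α) (κ ∘ cast (sum-merge α)) c ≡ merge (colourWeight α κ c)
colourWeight-merge α κ c = begin
  colourWeight (merge α) (κ ∘ cast p) c
    ≡⟨ histogram-cast p (λ v → κ (cast p v) ≟ c) (block (merge α)) ⟩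
  histogram (λ v → κ (cast p (cast (sym p) v)) ≟ c) (block (merge α) ∘ cast (sym p))
    ≡⟨ histogram-cong (λ v → transˡ-⇔ (cong κ (cast-involutive p (sym p) v))) (block-merge α)
                        (λ v → κ (cast p (cast (sym p) v)) ≟ c) (λ v → κ v ≟ c) ⟩
  histogram (λ v → κ v ≟ c) (mergeIndex ∘ block α)
    ≡⟨ histogram-merge (λ v → κ v ≟ c) (block α) ⟩
  merge (colourWeight α κ c)
    ∎
  where
  open ≡-Reasoning
  p = sum-merge α

colourWeight-≗ : ∀ {k} (α : Vec ℕ k) {N} {κ₁ κ₂ : Fin (sum α) → Fin N} → (∀ v → κ₁ v ≡ κ₂ v) →
  ∀ c → colourWeight α κ₁ c ≡ colourWeight α κ₂ c
colourWeight-≗ α {κ₁ = κ₁} {κ₂} κ₁≗κ₂ c =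
  histogram-cong (λ v → transˡ-⇔ (κ₁≗κ₂ v)) (λ _ → refl) (λ v → κ₁ v ≟ c) (λ v → κ₂ v ≟ c)

Proper-≗ : ∀ {k} (G : Graph k) {N} {κ₁ κ₂ : Fin (sum (α G)) → Fin N} → (∀ v → κ₁ v ≡ κ₂ v) →
  Proper G κ₁ ⇔ Proper G κ₂
Proper-≗ G κ₁≗κ₂ = mk⇔ (All.map λ {e} → subst₂ _≢_ (κ₁≗κ₂ (proj₁ e)) (κ₁≗κ₂ (proj₂ e)))
                        (All.map λ {e} → subst₂ _≢_ (sym (κ₁≗κ₂ (proj₁ e))) (sym (κ₁≗κ₂ (proj₂ e))))

Proper-πΓ⇔ : ∀ {k} (G : Graph (2 + k)) {N} (κ′ : Fin (sum (merge (α G))) → Fin N) →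
  Proper (πΓ G) κ′ ⇔ Proper G (κ′ ∘ cast (sym (sum-merge (α G))))
Proper-πΓ⇔ G κ′ = mk⇔ All.map⁻ All.map⁺

module FibreFamilies {A B : Set} (_≟ᴬ_ : DecidableEquality A) (_≟ᴮ_ : DecidableEquality B)
  (φ : A → B) (fibre : B → List A)
  (∑-fibre : ∀ x y → ∑ (fibre y) (λ u → 𝟙 (x ≟ᴬ u)) ≡ 𝟙 (φ x ≟ᴮ y)) where

  families : ∀ N → (Fin N → B) → List (Fin N → A)
  families zero    e = Vector.[] ∷ []
  families (suc N) e = concatMap (λ u → map (u Vector.∷_) (families N (e ∘ suc))) (fibre (e zero))

  ∑-families : ∀ N (e : Fin N → B) (w : Fin N → A) →
    ∑ (families N e) (λ e′ → 𝟙 (allFin? (λ c → w c ≟ᴬ e′ c))) ≡ 𝟙 (allFin? (λ c → φ (w c) ≟ᴮ e c))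
  ∑-families zero e w =
    trans (ℕ.+-identityʳ _) (𝟙-cong (mk⇔ (λ _ ()) (λ _ ()))
      (allFin? (λ c → w c ≟ᴬ Vector.[] c)) (allFin? (λ c → φ (w c) ≟ᴮ e c)))
  ∑-families (suc N) e w = begin
    ∑ (families (suc N) e) matches
      ≡⟨ ∑-concatMap _ (fibre (e zero)) matches ⟩
    ∑ (fibre (e zero)) (λ u → ∑ (map (u Vector.∷_) (families N (e ∘ suc))) matches)
      ≡⟨ ∑-cong (fibre (e zero)) (λ u → ∑-map (u Vector.∷_) (families N (e ∘ suc)) matches) ⟩
    ∑ (fibre (e zero)) (λ u → ∑ (families N (e ∘ suc)) (λ f → matches (u Vector.∷ f)))
      ≡⟨ ∑-cong (fibre (e zero)) (λ u → trans
           (∑-cong (families N (e ∘ suc)) (λ f → 𝟙-allFin-cons (λ c → w c ≟ᴬ (u Vector.∷ f) c)))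
           (∑-*ˡ (𝟙 (w zero ≟ᴬ u)) (families N (e ∘ suc)) _)) ⟩
    ∑ (fibre (e zero)) (λ u → 𝟙 (w zero ≟ᴬ u) *
      ∑ (families N (e ∘ suc)) (λ f → 𝟙 (allFin? (λ c → w (suc c) ≟ᴬ f c))))
      ≡⟨ ∑-cong (fibre (e zero)) (λ u → cong (𝟙 (w zero ≟ᴬ u) *_) (∑-families N (e ∘ suc) (w ∘ suc))) ⟩
    ∑ (fibre (e zero)) (λ u → 𝟙 (w zero ≟ᴬ u) * 𝟙 (allFin? (λ c → φ (w (suc c)) ≟ᴮ e (suc c))))
      ≡⟨ ∑-*ʳ _ (fibre (e zero)) (λ u → 𝟙 (w zero ≟ᴬ u)) ⟩
    ∑ (fibre (e zero)) (λ u → 𝟙 (w zero ≟ᴬ u)) * 𝟙 (allFin? (λ c → φ (w (suc c)) ≟ᴮ e (suc c)))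
      ≡⟨ cong (_* _) (∑-fibre (w zero) (e zero)) ⟩
    𝟙 (φ (w zero) ≟ᴮ e zero) * 𝟙 (allFin? (λ c → φ (w (suc c)) ≟ᴮ e (suc c)))
      ≡⟨ 𝟙-allFin-cons (λ c → φ (w c) ≟ᴮ e c) ⟨
    𝟙 (allFin? (λ c → φ (w c) ≟ᴮ e c))
      ∎
    where
    open ≡-Reasoning
    matches : (Fin (suc N) → A) → ℕ
    matches e′ = 𝟙 (allFin? (λ c → w c ≟ᴬ e′ c))

+≡⇔<×≡∸ : ∀ a b t → (a < suc t × b ≡ t ∸ a) ⇔ (a + b ≡ t)
+≡⇔<×≡∸ a b t = mk⇔ (λ { (a<1+t , refl) → ℕ.m+[n∸m]≡n (ℕ.≤-pred a<1+t) })
                (λ { refl → s≤s (ℕ.m≤m+n a b) , sym (ℕ.m+n∸m≡n a b) })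

mergePreimages : ∀ {k} → Vec ℕ (suc k) → List (Vec ℕ (2 + k))
mergePreimages {zero}  (t ∷ []) = map (λ a → a ∷ t ∸ a ∷ []) (downFrom (suc t))
mergePreimages {suc k} (b ∷ v)  = map (b ∷_) (mergePreimages v)

∑-mergePreimages : ∀ {k} (w : Vec ℕ (2 + k)) (v : Vec ℕ (suc k)) →
  ∑ (mergePreimages v) (λ u → 𝟙 (w ≟ᵛ u)) ≡ 𝟙 (merge w ≟ᵛ v)
∑-mergePreimages {zero} (a ∷ b ∷ []) (t ∷ []) = begin
  ∑ (mergePreimages (t ∷ [])) (λ u → 𝟙 ((a ∷ b ∷ []) ≟ᵛ u))
    ≡⟨ ∑-map _ (downFrom (suc t)) _ ⟩
  ∑ (downFrom (suc t)) (λ x → 𝟙 ((a ∷ b ∷ []) ≟ᵛ (x ∷ t ∸ x ∷ [])))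
    ≡⟨ ∑-cong (downFrom (suc t)) (λ x →
         trans (𝟙-∷ a x (b ∷ []) (t ∸ x ∷ [])) (cong (𝟙 (a ℕ.≟ x) *_) (𝟙-∷[] b (t ∸ x)))) ⟩
  ∑ (downFrom (suc t)) (λ x → 𝟙 (a ℕ.≟ x) * 𝟙 (b ℕ.≟ t ∸ x))
    ≡⟨ ∑-downFrom-sift a (suc t) (λ x → 𝟙 (b ℕ.≟ t ∸ x)) ⟩
  𝟙 (a ℕ.<? suc t) * 𝟙 (b ℕ.≟ t ∸ a)
    ≡⟨ 𝟙-× (a ℕ.<? suc t) (b ℕ.≟ t ∸ a) ⟨
  𝟙 (a ℕ.<? suc t ×-dec b ℕ.≟ t ∸ a)
    ≡⟨ 𝟙-cong (+≡⇔<×≡∸ a b t) (a ℕ.<? suc t ×-dec b ℕ.≟ t ∸ a) (a + b ℕ.≟ t) ⟩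
  𝟙 (a + b ℕ.≟ t)
    ≡⟨ 𝟙-∷[] (a + b) t ⟨
  𝟙 ((a + b ∷ []) ≟ᵛ (t ∷ []))
    ∎
  where open ≡-Reasoning
∑-mergePreimages {suc k} (a ∷ w) (b ∷ v) = begin
  ∑ (map (b ∷_) (mergePreimages v)) (λ u → 𝟙 ((a ∷ w) ≟ᵛ u))
    ≡⟨ ∑-map (b ∷_) (mergePreimages v) _ ⟩
  ∑ (mergePreimages v) (λ u → 𝟙 ((a ∷ w) ≟ᵛ (b ∷ u)))
    ≡⟨ ∑-cong (mergePreimages v) (𝟙-∷ a b w) ⟩
  ∑ (mergePreimages v) (λ u → 𝟙 (a ℕ.≟ b) * 𝟙 (w ≟ᵛ u))
    ≡⟨ ∑-*ˡ (𝟙 (a ℕ.≟ b)) (mergePreimages v) _ ⟩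
  𝟙 (a ℕ.≟ b) * ∑ (mergePreimages v) (λ u → 𝟙 (w ≟ᵛ u))
    ≡⟨ cong (𝟙 (a ℕ.≟ b) *_) (∑-mergePreimages w v) ⟩
  𝟙 (a ℕ.≟ b) * 𝟙 (merge w ≟ᵛ v)
    ≡⟨ 𝟙-∷ a b (merge w) v ⟨
  𝟙 ((a ∷ merge w) ≟ᵛ (b ∷ v))
    ∎
  where open ≡-Reasoning

module Refinements {k : ℕ} =
  FibreFamilies (_≟ᵛ_ {2 + k}) (_≟ᵛ_ {suc k}) merge mergePreimages ∑-mergePreimages
open Refinements using () renaming (families to refinements; ∑-families to ∑-refinements)

weight? : ∀ {k} (α : Vec ℕ k) {N} (κ : Fin (sum α) → Fin N) (e : Fin N → Vec ℕ k) →
  Dec (∀ c → colourWeight α κ c ≡ e c)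
weight? α κ e = allFin? (λ c → colourWeight α κ c ≟ᵛ e c)

mergedWeight? : ∀ {k} (α : Vec ℕ (2 + k)) {N} (κ : Fin (sum α) → Fin N) (e : Fin N → Vec ℕ (suc k)) →
  Dec (∀ c → merge (colourWeight α κ c) ≡ e c)
mergedWeight? α κ e = allFin? (λ c → merge (colourWeight α κ c) ≟ᵛ e c)

properOfWeight : ∀ {k} (G : Graph k) {N} (e : Fin N → Vec ℕ k) → (Fin (sum (α G)) → Fin N) → ℕ
properOfWeight G e κ = 𝟙 (proper? G κ ×-dec weight? (α G) κ e)

coeffX≡∑ : ∀ {k} (G : Graph k) N e → coeffX G N e ≡ ∑ (allFuns (sum (α G)) N) (properOfWeight G e)
coeffX≡∑ G N e = length-filter≡∑𝟙 (λ κ → proper? G κ ×-dec weight? (α G) κ e) (allFuns (sum (α G)) N)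

properOfWeight-≗ : ∀ {k} (G : Graph k) {N} (e : Fin N → Vec ℕ k) {κ₁ κ₂ : Fin (sum (α G)) → Fin N} →
  (∀ v → κ₁ v ≡ κ₂ v) → properOfWeight G e κ₁ ≡ properOfWeight G e κ₂
properOfWeight-≗ G e {κ₁} {κ₂} κ₁≗κ₂ =
  𝟙-cong (Proper-≗ G κ₁≗κ₂ ×-⇔ ∀-transˡ-⇔ (colourWeight-≗ (α G) κ₁≗κ₂))
         (proper? G κ₁ ×-dec weight? (α G) κ₁ e) (proper? G κ₂ ×-dec weight? (α G) κ₂ e)

-- κ ∘ cast refl agrees with κ only pointwise, hence the hypothesis on f.
∑-allFuns-cast : ∀ {m n N} (m≡n : m ≡ n) (f : (Fin m → Fin N) → ℕ) →
  (∀ {κ₁ κ₂} → (∀ v → κ₁ v ≡ κ₂ v) → f κ₁ ≡ f κ₂) →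
  ∑ (allFuns m N) f ≡ ∑ (allFuns n N) (λ κ → f (κ ∘ cast m≡n))
∑-allFuns-cast {m} {N = N} refl f f-resp =
  ∑-cong (allFuns m N) (λ κ → f-resp (λ v → sym (cong κ (cast-is-id refl v))))

coeffX-πΓ : ∀ {k} (G : Graph (2 + k)) N e → coeffX (πΓ G) N e ≡
  ∑ (allFuns (sum (α G)) N) (λ κ → 𝟙 (proper? G κ ×-dec mergedWeight? (α G) κ e))
coeffX-πΓ G@(graph α _) N e = begin
  coeffX (πΓ G) N e
    ≡⟨ coeffX≡∑ (πΓ G) N e ⟩
  ∑ (allFuns (sum (merge α)) N) (properOfWeight (πΓ G) e)
    ≡⟨ ∑-allFuns-cast p (properOfWeight (πΓ G) e) (properOfWeight-≗ (πΓ G) e) ⟩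
  ∑ (allFuns (sum α) N) (λ κ → properOfWeight (πΓ G) e (κ ∘ cast p))
    ≡⟨ ∑-cong (allFuns (sum α) N) (λ κ → 𝟙-cong (proper⇔ κ ×-⇔ weight⇔ κ)
         (proper? (πΓ G) (κ ∘ cast p) ×-dec weight? (merge α) (κ ∘ cast p) e)
         (proper? G κ ×-dec mergedWeight? α κ e)) ⟩
  ∑ (allFuns (sum α) N) (λ κ → 𝟙 (proper? G κ ×-dec mergedWeight? α κ e))
    ∎
  where
  open ≡-Reasoning
  p = sum-merge α
  proper⇔ : ∀ κ → Proper (πΓ G) (κ ∘ cast p) ⇔ Proper G κ
  proper⇔ κ =
    ⇔.trans (Proper-πΓ⇔ G (κ ∘ cast p)) (Proper-≗ G (λ v → cong κ (cast-involutive p (sym p) v)))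
  weight⇔ : ∀ κ → (∀ c → colourWeight (merge α) (κ ∘ cast p) c ≡ e c) ⇔
                  (∀ c → merge (colourWeight α κ c) ≡ e c)
  weight⇔ κ = ∀-transˡ-⇔ (colourWeight-merge α κ)

coeffX-πΓ≡∑-refinements : ∀ {k} (G : Graph (2 + k)) N e →
  coeffX (πΓ G) N e ≡ ∑ (refinements N e) (coeffX G N)
coeffX-πΓ≡∑-refinements G@(graph α _) N e = begin
  coeffX (πΓ G) N e
    ≡⟨ coeffX-πΓ G N e ⟩
  ∑ κs (λ κ → 𝟙 (proper? G κ ×-dec mergedWeight? α κ e))
    ≡⟨ ∑-cong κs (λ κ → trans (𝟙-× (proper? G κ) (mergedWeight? α κ e))
         (cong (𝟙 (proper? G κ) *_) (sym (∑-refinements N e (colourWeight α κ))))) ⟩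
  ∑ κs (λ κ → 𝟙 (proper? G κ) * ∑ (refinements N e) (λ e′ → 𝟙 (weight? α κ e′)))
    ≡⟨ ∑-cong κs (λ κ → sym (∑-*ˡ (𝟙 (proper? G κ)) (refinements N e) _)) ⟩
  ∑ κs (λ κ → ∑ (refinements N e) (λ e′ → 𝟙 (proper? G κ) * 𝟙 (weight? α κ e′)))
    ≡⟨ ∑-swap κs (refinements N e) (λ κ e′ → 𝟙 (proper? G κ) * 𝟙 (weight? α κ e′)) ⟩
  ∑ (refinements N e) (λ e′ → ∑ κs (λ κ → 𝟙 (proper? G κ) * 𝟙 (weight? α κ e′)))
    ≡⟨ ∑-cong (refinements N e) (λ e′ →
         trans (∑-cong κs (λ κ → sym (𝟙-× (proper? G κ) (weight? α κ e′)))) (sym (coeffX≡∑ G N e′))) ⟩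
  ∑ (refinements N e) (coeffX G N)
    ∎
  where
  open ≡-Reasoning
  κs = allFuns (sum α) N

module _ {c ℓ} (R : CommutativeRing c ℓ) where
  open CommutativeRing R
    using (Carrier; _≈_; 0#; 1#; setoid; reflexive; +-cong; +-identityˡ; *-congˡ; distribˡ; zeroʳ;
           +-rawMonoid; +-monoid; +-commutativeMonoid)
    renaming (_+_ to _+ᴿ_; _*_ to _*ᴿ_; trans to ≈-trans)
  open RawMonoid +-rawMonoid using () renaming (_×_ to _·ℕ_; sum to Σᴿ)
  open import Algebra.Properties.Monoid.Mult +-monoid using (×-homo-+)
  open import Algebra.Properties.Monoid.Sum +-monoid using (sum-cong-≋; sum-replicate-zero)
  open import Algebra.Properties.CommutativeMonoid.Sum +-commutativeMonoid using (∑-distrib-+)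
  open import Relation.Binary.Reasoning.Setoid setoid

  -- InKerX R L says: weightedCount (coef L) (λ i → coeffX (term L i) N e) ≈ 0# for all N, e.
  weightedCount : ∀ {m} → (Fin m → Carrier) → (Fin m → ℕ) → Carrier
  weightedCount cf a = Σᴿ (λ i → cf i *ᴿ (a i ·ℕ 1#))

  weightedCount-cong : ∀ {m} (cf : Fin m → Carrier) {a b : Fin m → ℕ} → (∀ i → a i ≡ b i) →
    weightedCount cf a ≈ weightedCount cf b
  weightedCount-cong cf a≗b = sum-cong-≋ (λ i → *-congˡ (reflexive (cong (_·ℕ 1#) (a≗b i))))

  weightedCount-+ : ∀ {m} (cf : Fin m → Carrier) (a b : Fin m → ℕ) →
    weightedCount cf (λ i → a i + b i) ≈ weightedCount cf a +ᴿ weightedCount cf b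
  weightedCount-+ cf a b = begin
    Σᴿ (λ i → cf i *ᴿ ((a i + b i) ·ℕ 1#))
      ≈⟨ sum-cong-≋ (λ i → ≈-trans (*-congˡ (×-homo-+ 1# (a i) (b i))) (distribˡ (cf i) _ _)) ⟩
    Σᴿ (λ i → cf i *ᴿ (a i ·ℕ 1#) +ᴿ cf i *ᴿ (b i ·ℕ 1#))
      ≈⟨ ∑-distrib-+ (λ i → cf i *ᴿ (a i ·ℕ 1#)) (λ i → cf i *ᴿ (b i ·ℕ 1#)) ⟩
    weightedCount cf a +ᴿ weightedCount cf b
      ∎

  weightedCount-zero : ∀ {m} (cf : Fin m → Carrier) → weightedCount cf (λ _ → 0) ≈ 0#
  weightedCount-zero {m} cf = ≈-trans (sum-cong-≋ (λ i → zeroʳ (cf i))) (sum-replicate-zero m)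

  weightedCount-∑ : ∀ {m} {A : Set} (cf : Fin m → Carrier) (a : Fin m → A → ℕ) →
    (∀ x → weightedCount cf (λ i → a i x) ≈ 0#) →
    ∀ xs → weightedCount cf (λ i → ∑ xs (a i)) ≈ 0#
  weightedCount-∑ cf a vanish []       = weightedCount-zero cf
  weightedCount-∑ cf a vanish (x ∷ xs) = begin
    weightedCount cf (λ i → a i x + ∑ xs (a i))
      ≈⟨ weightedCount-+ cf (λ i → a i x) (λ i → ∑ xs (a i)) ⟩
    weightedCount cf (λ i → a i x) +ᴿ weightedCount cf (λ i → ∑ xs (a i))
      ≈⟨ +-cong (vanish x) (weightedCount-∑ cf a vanish xs) ⟩
    0# +ᴿ 0#
      ≈⟨ +-identityˡ 0# ⟩
    0#
      ∎

  InKerX-πΓ : ∀ {k m} (cf : Fin m → Carrier) (H : Fin m → Graph (2 + k)) →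
    InKerX R (lincomb m cf H) → InKerX R (lincomb m cf (πΓ ∘ H))
  InKerX-πΓ cf H inKer N e = begin
    weightedCount cf (λ i → coeffX (πΓ (H i)) N e)
      ≈⟨ weightedCount-cong cf (λ i → coeffX-πΓ≡∑-refinements (H i) N e) ⟩
    weightedCount cf (λ i → ∑ (refinements N e) (coeffX (H i) N))
      ≈⟨ weightedCount-∑ cf (λ i → coeffX (H i) N) (inKer N) (refinements N e) ⟩
    0#
      ∎

  InKerX-πAll : ∀ {k m} (cf : Fin m → Carrier) (H : Fin m → Graph (suc k)) →
    InKerX R (lincomb m cf H) → InKerX R (lincomb m cf (πAll ∘ H))
  InKerX-πAll {zero}  cf H inKer = inKer
  InKerX-πAll {suc k} cf H = InKerX-πAll cf (πΓ ∘ H) ∘ InKerX-πΓ cf H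

corollary5p3 : {c ℓ : Level} (R : CommutativeRing c ℓ) (k : ℕ)
    (L : LinComb R (suc (suc k))) →
    (∀ (i : Fin (LinComb.m L)) → Loopless (LinComb.term L i)) →
    InKerX R L → InKerX R (πL R L)
corollary5p3 R k (lincomb m cf H) _ = InKerX-πAll R cf H
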